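{- Let $T$ be a tree and let $v$ be a vertex of $T$. If $T$ is not NEB at $v$, then there is a vertex $w$ of $T$ such that the forest $T(w)$ has at least two connected components with an odd number of vertices.
   Context: For a tree $T$ and a vertex $v$, $T(v)$ denotes the forest obtained from $T$ by deleting $v$, and for a neighbor $w$ of $v$, $T_w(v)$ denotes the connected component of $T(v)$ containing $w$ (a tree). A component is odd if it has an odd number of vertices. NEB ("nearly even branching") is defined recursively: let $T$ be a tree on $n$ vertices and $w$ a vertex of $T$. If $n=1$, $T$ is NEB at $w$. If $n\ge 2$, $T$ is NEB at $w$ if (i) $T(w)$ has exactly one odd component when $n$ is even, and $T(w)$ has no odd component when $n$ is odd; and (ii) for each neighbor $v$ of $w$ in $T$, the tree $T_v(w)$ is NEB at $v$. -}

module Defs where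

open import Data.Nat using (ℕ; suc; _≤_; _%_)
open import Data.Fin using (Fin)
open import Data.Fin.Subset using (Subset; _∈_; _∉_; ∣_∣; ⊤)
open import Data.List using (List; []; _∷_; length)
open import Data.List.Relation.Unary.Unique.Propositional using (Unique)
open import Data.Product using (Σ; ∃; _×_; _,_)
open import Relation.Binary.PropositionalEquality using (_≡_; _≢_)
open import Relation.Nullary using (¬_)

record SimpleGraph (n : ℕ) : Set₁ where
  field
    Adj    : Fin n → Fin n → Set
    sym    : ∀ {x y} → Adj x y → Adj y x
    irrefl : ∀ {x} → ¬ Adj x x
open SimpleGraph public

module _ {n : ℕ} (G : SimpleGraph n) where

  -- Reach S w u v : there is a walk from u to v in G all of whose vertices
  -- lie in S and differ from w  (i.e. a walk in the induced graph G[S] - w).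
  data Reach (S : Subset n) (w : Fin n) : Fin n → Fin n → Set where
    here : ∀ {u} → u ∈ S → u ≢ w → Reach S w u u
    step : ∀ {u x v} → u ∈ S → u ≢ w → Adj G u x → Reach S w x v → Reach S w u v

  data Walk (S : Subset n) : Fin n → Fin n → Set where
    here : ∀ {u} → u ∈ S → Walk S u u
    step : ∀ {u x v} → u ∈ S → Adj G u x → Walk S x v → Walk S u v

  data Path : List (Fin n) → Set where
    nil  : Path []
    one  : ∀ x → Path (x ∷ [])
    cons : ∀ {x y xs} → Adj G x y → Path (y ∷ xs) → Path (x ∷ y ∷ xs)

  data LastOf : Fin n → List (Fin n) → Fin n → Set where
    single : ∀ {x} → LastOf x [] x
    more   : ∀ {x y ys z} → LastOf y ys z → LastOf x (y ∷ ys) z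

  record Cycle : Set where
    field
      x₀    : Fin n
      rest  : List (Fin n)
      last  : Fin n
      len   : 3 ≤ length (x₀ ∷ rest)
      uniq  : Unique (x₀ ∷ rest)
      path  : Path (x₀ ∷ rest)
      isLast : LastOf x₀ rest last
      close : Adj G last x₀

  IsTree : Set
  IsTree = (∀ u v → Walk ⊤ u v) × ¬ Cycle

  IsComp : Subset n → Fin n → Fin n → Subset n → Set
  IsComp S w u C = ∀ x → (x ∈ C → Reach S w u x) × (Reach S w u x → x ∈ C)

  Odd : ℕ → Set
  Odd m = m % 2 ≡ 1

  OddComp : Subset n → Fin n → Fin n → Set
  OddComp S w u = Σ (Subset n) λ C → IsComp S w u C × Odd ∣ C ∣

  -- NEB for the subtree G[S] at w ∈ S (S is the vertex set of a subtree).
  -- |S| = 1 is covered: then G[S] - w has no vertices, so both conditions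
  -- hold vacuously.  The inductive type is the least fixed point, matching
  -- the recursive definition (components are strictly smaller).
  data NEB (S : Subset n) (w : Fin n) : Set where
    neb :
      -- (i) n even: exactly one odd component of T(w)
      (¬ Odd ∣ S ∣ →
         (Σ (Fin n) λ u → u ∈ S × u ≢ w × OddComp S w u)
         × (∀ u u' → u ∈ S → u ≢ w → u' ∈ S → u' ≢ w →
              OddComp S w u → OddComp S w u' → Reach S w u u'))
      → (Odd ∣ S ∣ → ∀ u → u ∈ S → u ≢ w → ¬ OddComp S w u)
      → (∀ v → v ∈ S → Adj G w v → ∀ C → IsComp S w v C → NEB C v)
      → NEB S w

-- Contrapositive: assume that for every vertex w the forest T(w) has at most one odd component,
-- and show that T is NEB at every vertex.  Counting mod 2, Σ_x |T_x(w)| = Σ_C |C|² ≡ Σ_C |C| = n − 1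
-- (the sum runs over the vertices x ≠ w, C over the components of T(w)).  Hence T(w) has an odd
-- component when n is even; under the assumption it has none when n is odd, so n is even as soon as
-- T has an edge.  For an edge yx the branches T_x(y) and T_y(x) partition T, so their sizes have the
-- same parity.  If |T_x(y)| is even, the odd component of T(x) is not T_y(x), so it lies in T_x(y);
-- if it is odd, T_y(x) is the unique odd component of T(x), and T_x(y) − x has none.  Induction on the
-- size of the branch gives NEB everywhere.  All notions involved are decidable, so the contrapositive
-- yields an explicit vertex with two odd components.

module Submission where

open import Defs
open import Data.Bool using (Bool; true; false)
open import Data.Nat using (ℕ; zero; suc; _+_; _%_; _<_; z≤n; s≤s; parity)
open import Data.Nat.Properties using (m+[n∸m]≡n)
open import Data.Nat.Induction using (<-wellFounded)
open import Data.Parity.Base as ℙ using (Parity; 0ℙ; 1ℙ; _⁻¹)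
open import Data.Parity.Properties as ℙ using (+-0-commutativeMonoid; ⁻¹-involutive; ⁻¹-injective; +-homo-+)
open import Data.Fin using (Fin; zero; suc; _≟_)
open import Data.Fin.Properties using (any?)
open import Data.Fin.Subset using (Subset; _∈_; _∉_; _⊂_; ⊤; ⊥; ∁; ⁅_⁆; ∣_∣; outside; inside)
open import Data.Fin.Subset.Properties
  using (_∈?_; ∈⊤; ⊆-antisym; Empty-unique; ∣⊥∣≡0; ∣⁅x⁆∣≡1; x∈⁅y⁆⇔x≡y; ∣⊤∣≡n; x∈∁p⇒x∉p; x∉p⇒x∈∁p; x∉∁p⇒x∈p; p⊂q⇒∣p∣<∣q∣; ∣p∣≤n; ∣∁p∣≡n∸∣p∣)
open import Data.List using (List; []; _∷_)
open import Data.List.Relation.Unary.All as All using (All; []; _∷_)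
open import Data.List.Relation.Unary.All.Properties using (¬Any⇒All¬)
open import Data.List.Relation.Unary.AllPairs using ([]; _∷_)
open import Data.List.Relation.Unary.Any using (here; there)
open import Data.List.Relation.Unary.Unique.Propositional using (Unique)
open import Data.Vec using ([]; _∷_; tabulate)
open import Data.Vec.Properties using (lookup∘tabulate; []=⇒lookup; lookup⇒[]=)
open import Data.Product using (Σ; ∃; _×_; _,_; proj₁; proj₂)
open import Data.Sum using (_⊎_; inj₁; inj₂)
open import Induction.WellFounded using (Acc; acc)
open import Function using (_∘_; mk⇔; Equivalence)
open import Relation.Nullary using (¬_; Dec; yes; no; does; contradiction)
open import Relation.Nullary.Decidable using (map′; dec-true; does-⇔; decidable-stable; _×-dec_; ¬?)
open import Relation.Binary.PropositionalEquality as ≡ using (_≡_; _≢_; refl; trans; cong; module ≡-Reasoning)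

open import Algebra.Properties.CommutativeMonoid.Sum +-0-commutativeMonoid using (sum-syntax; sum-cong-≗; ∑-distrib-+)

toParity : Bool → Parity
toParity false = 0ℙ
toParity true  = 1ℙ

odd⇒parity≡1ℙ : ∀ m → m % 2 ≡ 1 → parity m ≡ 1ℙ
odd⇒parity≡1ℙ 1             _   = refl
odd⇒parity≡1ℙ (suc (suc m)) odd = odd⇒parity≡1ℙ m odd

parity≡1ℙ⇒odd : ∀ m → parity m ≡ 1ℙ → m % 2 ≡ 1
parity≡1ℙ⇒odd 1             _  = refl
parity≡1ℙ⇒odd (suc (suc m)) eq = parity≡1ℙ⇒odd m eq

p≢1ℙ⇒p≡0ℙ : ∀ {p} → p ≢ 1ℙ → p ≡ 0ℙ
p≢1ℙ⇒p≡0ℙ {0ℙ} _   = refl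
p≢1ℙ⇒p≡0ℙ {1ℙ} p≢1 = contradiction refl p≢1

∑≡1ℙ⇒∃ : ∀ {m} (f : Fin m → Parity) → ∑[ i < m ] f i ≡ 1ℙ → ∃ λ i → f i ≡ 1ℙ
∑≡1ℙ⇒∃ {suc m} f eq with f zero in f₀
... | 1ℙ = zero , f₀
... | 0ℙ = let i , fi = ∑≡1ℙ⇒∃ (f ∘ suc) eq in suc i , fi

p+q≡0ℙ⇒p≡q : ∀ {p q} → p ℙ.+ q ≡ 0ℙ → p ≡ q
p+q≡0ℙ⇒p≡q {0ℙ} {0ℙ} _ = refl
p+q≡0ℙ⇒p≡q {1ℙ} {1ℙ} _ = refl

private
  cancel-middle : ∀ p q r → (p ℙ.+ q) ℙ.+ (q ℙ.+ r) ≡ p ℙ.+ r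
  cancel-middle 0ℙ 0ℙ r = refl
  cancel-middle 0ℙ 1ℙ r = ⁻¹-involutive r
  cancel-middle 1ℙ 0ℙ r = refl
  cancel-middle 1ℙ 1ℙ r = refl

-- Off-diagonal entries of a symmetric matrix come in equal pairs, which cancel mod 2.
∑∑-symmetric : ∀ {m} (M : Fin m → Fin m → Parity) → (∀ i j → M i j ≡ M j i) →
               ∑[ i < m ] ∑[ j < m ] M i j ≡ ∑[ i < m ] M i i
∑∑-symmetric {zero}  M M-sym = refl
∑∑-symmetric {suc m} M M-sym = begin
  (M zero zero ℙ.+ row) ℙ.+ ∑[ i < m ] (M (suc i) zero ℙ.+ ∑[ j < m ] M′ i j)
    ≡⟨ cong ((M zero zero ℙ.+ row) ℙ.+_) (∑-distrib-+ (λ i → M (suc i) zero) (λ i → ∑[ j < m ] M′ i j)) ⟩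
  (M zero zero ℙ.+ row) ℙ.+ (column ℙ.+ ∑[ i < m ] ∑[ j < m ] M′ i j)
    ≡⟨ cong (λ c → (M zero zero ℙ.+ row) ℙ.+ (c ℙ.+ ∑[ i < m ] ∑[ j < m ] M′ i j)) column≡row ⟩
  (M zero zero ℙ.+ row) ℙ.+ (row ℙ.+ ∑[ i < m ] ∑[ j < m ] M′ i j)
    ≡⟨ cancel-middle (M zero zero) row _ ⟩
  M zero zero ℙ.+ ∑[ i < m ] ∑[ j < m ] M′ i j
    ≡⟨ cong (M zero zero ℙ.+_) (∑∑-symmetric M′ (λ i j → M-sym (suc i) (suc j))) ⟩
  M zero zero ℙ.+ ∑[ i < m ] M′ i i ∎
  where
  open ≡-Reasoning
  M′ : Fin m → Fin m → Parity
  M′ i j = M (suc i) (suc j)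
  row column : Parity
  row    = ∑[ j < m ] M zero (suc j)
  column = ∑[ i < m ] M (suc i) zero
  column≡row : column ≡ row
  column≡row = sum-cong-≗ (λ i → M-sym (suc i) zero)

parity∣p∣≡∑ : ∀ {m} (p : Subset m) → parity ∣ p ∣ ≡ ∑[ i < m ] toParity (does (i ∈? p))
parity∣p∣≡∑ []            = refl
parity∣p∣≡∑ (outside ∷ p) = parity∣p∣≡∑ p
parity∣p∣≡∑ (inside  ∷ p) = trans (+-homo-+ 1 ∣ p ∣) (cong (1ℙ ℙ.+_) (parity∣p∣≡∑ p))

∣p∣+∣∁p∣≡n : ∀ {m} (p : Subset m) → ∣ p ∣ + ∣ ∁ p ∣ ≡ m
∣p∣+∣∁p∣≡n p = trans (cong (∣ p ∣ +_) (∣∁p∣≡n∸∣p∣ p)) (m+[n∸m]≡n (∣p∣≤n p))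

comprehension : ∀ {m} {P : Fin m → Set} → (∀ x → Dec (P x)) → Subset m
comprehension P? = tabulate (does ∘ P?)

module _ {m} {P : Fin m → Set} (P? : ∀ x → Dec (P x)) where

  ∈comprehension⇒ : ∀ {x} → x ∈ comprehension P? → P x
  ∈comprehension⇒ {x} x∈ with P? x | trans (≡.sym (lookup∘tabulate (does ∘ P?) x)) ([]=⇒lookup x∈)
  ... | yes px | _ = px

  ⇒∈comprehension : ∀ {x} → P x → x ∈ comprehension P?
  ⇒∈comprehension {x} px = lookup⇒[]= x _ (trans (lookup∘tabulate (does ∘ P?) x) (dec-true (P? x) px))

module Reachability {n : ℕ} (G : SimpleGraph n) where

  open import Data.List.Membership.DecPropositional (_≟_ {n}) using () renaming (_∈_ to _∈ₗ_; _∈?_ to _∈ₗ?_)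

  Reach-source≢ : ∀ {S w a b} → Reach G S w a b → a ≢ w
  Reach-source≢ (here _ a≢w)     = a≢w
  Reach-source≢ (step _ a≢w _ _) = a≢w

  Reach-target≢ : ∀ {S w a b} → Reach G S w a b → b ≢ w
  Reach-target≢ (here _ b≢w)   = b≢w
  Reach-target≢ (step _ _ _ r) = Reach-target≢ r

  Reach-snoc : ∀ {S w a b c} → Reach G S w a b → Adj G b c → c ∈ S → c ≢ w → Reach G S w a c
  Reach-snoc (here b∈S b≢w)     bc c∈S c≢w = step b∈S b≢w bc (here c∈S c≢w)
  Reach-snoc (step a∈S a≢w ax r) bc c∈S c≢w = step a∈S a≢w ax (Reach-snoc r bc c∈S c≢w)

  Reach-sym : ∀ {S w a b} → Reach G S w a b → Reach G S w b a
  Reach-sym (here a∈S a≢w)      = here a∈S a≢w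
  Reach-sym (step a∈S a≢w ax r) = Reach-snoc (Reach-sym r) (sym G ax) a∈S a≢w

  Reach-trans : ∀ {S w a b c} → Reach G S w a b → Reach G S w b c → Reach G S w a c
  Reach-trans (here _ _)          r′ = r′
  Reach-trans (step a∈S a≢w ax r) r′ = step a∈S a≢w ax (Reach-trans r r′)

  Reach⇒Reach⊤ : ∀ {S w a b} → Reach G S w a b → Reach G ⊤ w a b
  Reach⇒Reach⊤ (here _ a≢w)     = here ∈⊤ a≢w
  Reach⇒Reach⊤ (step _ a≢w ax r) = step ∈⊤ a≢w ax (Reach⇒Reach⊤ r)

  Reach⊤⇒Reach : ∀ {S w a b} → (∀ {c} → Reach G ⊤ w a c → c ∈ S) → Reach G ⊤ w a b → Reach G S w a b
  Reach⊤⇒Reach closed (here _ a≢w)      = here (closed (here ∈⊤ a≢w)) a≢w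
  Reach⊤⇒Reach closed (step _ a≢w ax r) =
    step (closed (here ∈⊤ a≢w)) a≢w ax (Reach⊤⇒Reach (closed ∘ step ∈⊤ a≢w ax) r)

  IsComp-unique : ∀ {S w u C C′} → IsComp G S w u C → IsComp G S w u C′ → C ≡ C′
  IsComp-unique C-comp C′-comp = ⊆-antisym
    (λ {x} x∈C → proj₂ (C′-comp x) (proj₁ (C-comp x) x∈C))
    (λ {x} x∈C′ → proj₂ (C-comp x) (proj₁ (C′-comp x) x∈C′))

  Walk⇒Reach-neighbour : ∀ {a w} → Walk G ⊤ a w → a ≢ w → ∃ λ q → Adj G w q × Reach G ⊤ w a q
  Walk⇒Reach-neighbour (here _) a≢w = contradiction refl a≢w
  Walk⇒Reach-neighbour {a} {w} (step {x = x} _ ax r) a≢w with x ≟ w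
  ... | yes refl = a , sym G ax , here ∈⊤ a≢w
  ... | no x≢w   = let q , wq , x~q = Walk⇒Reach-neighbour r x≢w in q , wq , step ∈⊤ a≢w ax x~q

  Walk⇒Reach-avoiding-one : ∀ {a b c} → a ≢ b → Walk G ⊤ c a → c ≢ b →
                            Reach G ⊤ b c a ⊎ Reach G ⊤ a c b
  Walk⇒Reach-avoiding-one a≢b (here _) c≢b = inj₁ (here ∈⊤ c≢b)
  Walk⇒Reach-avoiding-one {a} {b} {c} a≢b (step {x = x} _ cx r) c≢b with c ≟ a | x ≟ b
  ... | yes refl | _        = inj₁ (here ∈⊤ c≢b)
  ... | no c≢a   | yes refl = inj₂ (step ∈⊤ c≢a cx (here ∈⊤ (a≢b ∘ ≡.sym)))
  ... | no c≢a   | no x≢b   with Walk⇒Reach-avoiding-one a≢b r x≢b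
  ...   | inj₁ x~a = inj₁ (step ∈⊤ c≢b cx x~a)
  ...   | inj₂ x~b = inj₂ (step ∈⊤ c≢a cx x~b)

  record SimplePath (w a b : Fin n) : Set where
    field
      rest    : List (Fin n)
      path    : Path G (a ∷ rest)
      unique  : Unique (a ∷ rest)
      avoids  : All (_≢ w) (a ∷ rest)
      ends-at : LastOf G a rest b

  SimplePath-suffix : ∀ {w u b} h t → u ∈ₗ (h ∷ t) → Path G (h ∷ t) → Unique (h ∷ t) →
                      All (_≢ w) (h ∷ t) → LastOf G h t b → SimplePath w u b
  SimplePath-suffix h t (here refl) p q a l = record { path = p ; unique = q ; avoids = a ; ends-at = l }
  SimplePath-suffix h (h′ ∷ t) (there u∈t) (cons _ p) (_ ∷ q) (_ ∷ a) (more l) =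
    SimplePath-suffix h′ t u∈t p q a l

  -- Prepending a vertex that already occurs on the path shortcuts the path instead.
  Reach⇒SimplePath : ∀ {S w a b} → Reach G S w a b → SimplePath w a b
  Reach⇒SimplePath (here _ a≢w) = record
    { rest = [] ; path = one _ ; unique = [] ∷ [] ; avoids = a≢w ∷ [] ; ends-at = single }
  Reach⇒SimplePath {a = a} (step {x = x} _ a≢w ax r) with Reach⇒SimplePath r
  ... | record { rest = t ; path = p ; unique = q ; avoids = av ; ends-at = l } with a ∈ₗ? (x ∷ t)
  ...   | yes a∈ = SimplePath-suffix x t a∈ p q av l
  ...   | no  a∉ = record
          { rest = x ∷ t ; path = cons ax p ; unique = ¬Any⇒All¬ _ a∉ ∷ q
          ; avoids = a≢w ∷ av ; ends-at = more l }

  -- A path from x to q in G − y, closed up through y, would be a cycle.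
  neighbours-separated : ¬ Cycle G → ∀ {S y x q} → Adj G y x → Adj G y q → Reach G S y x q → q ≡ x
  neighbours-separated acyclic {y = y} {x} {q} yx yq r with q ≟ x | Reach⇒SimplePath r
  ... | yes q≡x | _ = q≡x
  ... | no q≢x | record { rest = [] ; ends-at = single } = contradiction refl q≢x
  ... | no q≢x | record { rest = z ∷ t ; path = p ; unique = u ; avoids = av ; ends-at = l } =
    contradiction cycle acyclic
    where
    cycle : Cycle G
    cycle = record
      { x₀ = y ; rest = x ∷ z ∷ t ; last = q ; len = s≤s (s≤s (s≤s z≤n))
      ; uniq = All.map (_∘ ≡.sym) av ∷ u ; path = cons yx p ; isLast = more l
      ; close = sym G yq }

module Tree {n : ℕ} (T : SimpleGraph n) (tree : IsTree T) where

  open Reachability T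

  connected : ∀ u v → Walk T ⊤ u v
  connected = proj₁ tree

  acyclic : ¬ Cycle T
  acyclic = proj₂ tree

  -- a and b are joined in T − w exactly when they reach w through the same neighbour.
  reach? : ∀ w a b → Dec (Reach T ⊤ w a b)
  reach? w a b with a ≟ w | b ≟ w
  ... | yes a≡w | _       = no (λ a~b → Reach-source≢ a~b a≡w)
  ... | no _    | yes b≡w = no (λ a~b → Reach-target≢ a~b b≡w)
  ... | no a≢w  | no b≢w
    with Walk⇒Reach-neighbour (connected a w) a≢w | Walk⇒Reach-neighbour (connected b w) b≢w
  ...   | q , wq , a~q | p , wp , b~p with p ≟ q
  ...     | yes refl = yes (Reach-trans a~q (Reach-sym b~p))
  ...     | no p≢q   = no λ a~b →
    p≢q (neighbours-separated acyclic wq wp (Reach-trans (Reach-sym a~q) (Reach-trans a~b b~p)))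

  component : Fin n → Fin n → Subset n
  component w u = comprehension (reach? w u)

  ∈component⇒Reach : ∀ {w u x} → x ∈ component w u → Reach T ⊤ w u x
  ∈component⇒Reach {w} {u} = ∈comprehension⇒ (reach? w u)

  Reach⇒∈component : ∀ {w u x} → Reach T ⊤ w u x → x ∈ component w u
  Reach⇒∈component {w} {u} = ⇒∈comprehension (reach? w u)

  component-IsComp : ∀ w u → IsComp T ⊤ w u (component w u)
  component-IsComp w u x = ∈component⇒Reach , Reach⇒∈component

  component-sym : ∀ {w x y} → y ∈ component w x → x ∈ component w y
  component-sym {w} {x} {y} y∈ = Reach⇒∈component (Reach-sym (∈component⇒Reach {w} {x} y∈))

  component-cong : ∀ {w u u′} → Reach T ⊤ w u u′ → component w u ≡ component w u′
  component-cong u~u′ = IsComp-unique (component-IsComp _ _) λ x →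
      (λ x∈ → Reach-trans u~u′ (∈component⇒Reach x∈))
    , (λ u~x → Reach⇒∈component (Reach-trans (Reach-sym u~u′) u~x))

  component-self : ∀ w → component w w ≡ ⊥
  component-self w = Empty-unique λ (x , x∈) → Reach-source≢ (∈component⇒Reach {w} {w} x∈) refl

  OddComp⇒odd : ∀ {w u} → OddComp T ⊤ w u → parity ∣ component w u ∣ ≡ 1ℙ
  OddComp⇒odd {w} {u} (C , C-comp , odd) =
    ≡.subst (λ D → parity ∣ D ∣ ≡ 1ℙ) (IsComp-unique C-comp (component-IsComp w u)) (odd⇒parity≡1ℙ ∣ C ∣ odd)

  odd⇒OddComp : ∀ {w u} → parity ∣ component w u ∣ ≡ 1ℙ → OddComp T ⊤ w u
  odd⇒OddComp {w} {u} odd = component w u , component-IsComp w u , parity≡1ℙ⇒odd ∣ component w u ∣ odd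

  oddComp? : ∀ w u → Dec (OddComp T ⊤ w u)
  oddComp? w u = map′ odd⇒OddComp OddComp⇒odd (parity ∣ component w u ∣ ℙ.≟ 1ℙ)

  odd-component⇒≢ : ∀ {w u} → parity ∣ component w u ∣ ≡ 1ℙ → u ≢ w
  odd-component⇒≢ {w} odd refl = contradiction even-size λ ()
    where
    even-size : 0ℙ ≡ 1ℙ
    even-size = begin
      0ℙ                          ≡⟨ cong parity (≡.sym (∣⊥∣≡0 n)) ⟩
      parity ∣ ⊥ {n} ∣            ≡⟨ cong (λ C → parity ∣ C ∣) (≡.sym (component-self w)) ⟩
      parity ∣ component w w ∣    ≡⟨ odd ⟩
      1ℙ                          ∎
      where open ≡-Reasoning

  -- The sum is Σ_C |C|², evaluated through the symmetric 0/1 matrix [y ∈ component w x].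
  parity-order : ∀ w → parity n ≡ (∑[ x < n ] parity ∣ component w x ∣) ⁻¹
  parity-order w = begin
    parity n                                                     ≡⟨ cong parity (≡.sym (∣p∣+∣∁p∣≡n ⁅ w ⁆)) ⟩
    parity (∣ ⁅ w ⁆ ∣ + ∣ ∁ ⁅ w ⁆ ∣)                              ≡⟨ cong (λ k → parity (k + ∣ ∁ ⁅ w ⁆ ∣)) (∣⁅x⁆∣≡1 w) ⟩
    parity (1 + ∣ ∁ ⁅ w ⁆ ∣)                                      ≡⟨ +-homo-+ 1 ∣ ∁ ⁅ w ⁆ ∣ ⟩
    1ℙ ℙ.+ parity ∣ ∁ ⁅ w ⁆ ∣                                     ≡⟨ cong (1ℙ ℙ.+_) (parity∣p∣≡∑ (∁ ⁅ w ⁆)) ⟩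
    1ℙ ℙ.+ ∑[ x < n ] toParity (does (x ∈? ∁ ⁅ w ⁆))              ≡⟨ cong (1ℙ ℙ.+_) (sum-cong-≗ diagonal) ⟩
    1ℙ ℙ.+ ∑[ x < n ] M x x                                       ≡⟨ cong (1ℙ ℙ.+_) (≡.sym (∑∑-symmetric M M-sym)) ⟩
    1ℙ ℙ.+ ∑[ x < n ] ∑[ y < n ] M x y                            ≡⟨ cong (1ℙ ℙ.+_) (sum-cong-≗ λ x → ≡.sym (parity∣p∣≡∑ (component w x))) ⟩
    1ℙ ℙ.+ ∑[ x < n ] parity ∣ component w x ∣                    ∎
    where
    open ≡-Reasoning
    open Equivalence
    M : Fin n → Fin n → Parity
    M x y = toParity (does (y ∈? component w x))
    M-sym : ∀ x y → M x y ≡ M y x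
    M-sym x y = cong toParity (does-⇔ (mk⇔ component-sym component-sym) (y ∈? component w x) (x ∈? component w y))
    diagonal : ∀ x → toParity (does (x ∈? ∁ ⁅ w ⁆)) ≡ M x x
    diagonal x = cong toParity (does-⇔ (mk⇔
      (λ x∈∁ → Reach⇒∈component (here ∈⊤ (x∈∁p⇒x∉p x∈∁ ∘ from x∈⁅y⁆⇔x≡y)))
      (λ x∈C → x∉p⇒x∈∁p (Reach-source≢ (∈component⇒Reach {w} {x} x∈C) ∘ to x∈⁅y⁆⇔x≡y)))
      (x ∈? ∁ ⁅ w ⁆) (x ∈? component w x))

  even-order⇒odd-component : parity n ≡ 0ℙ → ∀ w → ∃ λ u → parity ∣ component w u ∣ ≡ 1ℙ
  even-order⇒odd-component even w = ∑≡1ℙ⇒∃ _ (⁻¹-injective (trans (≡.sym (parity-order w)) even))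

  two-odd-components? : Dec (∃ λ w → ∃ λ u → ∃ λ u′ →
                              OddComp T ⊤ w u × OddComp T ⊤ w u′ × ¬ Reach T ⊤ w u u′)
  two-odd-components? = any? λ w → any? λ u → any? λ u′ →
    oddComp? w u ×-dec oddComp? w u′ ×-dec ¬? (reach? w u u′)

  AtMostOneOddComponent : Set
  AtMostOneOddComponent = ∀ w u u′ → OddComp T ⊤ w u → OddComp T ⊤ w u′ → Reach T ⊤ w u u′

  -- With a single odd component C, the sum in parity-order counts the members of C.
  odd-component⇒even-order : AtMostOneOddComponent →
                             ∀ {w u} → parity ∣ component w u ∣ ≡ 1ℙ → parity n ≡ 0ℙ
  odd-component⇒even-order unique {w} {u} odd = begin
    parity n                                                ≡⟨ parity-order w ⟩
    (∑[ x < n ] parity ∣ component w x ∣) ⁻¹                ≡⟨ cong _⁻¹ (sum-cong-≗ odd⇔∈C) ⟩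
    (∑[ x < n ] toParity (does (x ∈? component w u))) ⁻¹    ≡⟨ cong _⁻¹ (≡.sym (parity∣p∣≡∑ (component w u))) ⟩
    (parity ∣ component w u ∣) ⁻¹                           ≡⟨ cong _⁻¹ odd ⟩
    0ℙ                                                      ∎
    where
    open ≡-Reasoning
    odd⇔∈C : ∀ x → parity ∣ component w x ∣ ≡ toParity (does (x ∈? component w u))
    odd⇔∈C x with x ∈? component w u
    ... | yes x∈C = trans (cong (λ C → parity ∣ C ∣) (≡.sym (component-cong (∈component⇒Reach {w} {u} x∈C)))) odd
    ... | no  x∉C = p≢1ℙ⇒p≡0ℙ λ oddₓ →
      x∉C (Reach⇒∈component (unique w u x (odd⇒OddComp odd) (odd⇒OddComp oddₓ)))

  module Edge {y x : Fin n} (yx : Adj T y x) where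

    x≢y : x ≢ y
    x≢y x≡y = irrefl T (≡.subst (Adj T y) x≡y yx)

    -- A walk onto y from the x-side would arrive through x, by neighbours-separated.
    x-side-closed : ∀ {a c} → Reach T ⊤ x a c → Reach T ⊤ y x c → Reach T ⊤ y x a
    x-side-closed (here _ _) x~c = x~c
    x-side-closed {a} (step _ a≢x aa′ a′~c) x~c with a ≟ y
    ... | yes refl = contradiction (neighbours-separated acyclic yx aa′ (x-side-closed a′~c x~c))
                                   (Reach-source≢ a′~c)
    ... | no a≢y   = Reach-snoc (x-side-closed a′~c x~c) (sym T aa′) ∈⊤ a≢y

    branch-closed : ∀ {a c} → c ∈ component y x → Reach T ⊤ x c a → a ∈ component y x
    branch-closed c∈ c~a = Reach⇒∈component (x-side-closed (Reach-sym c~a) (∈component⇒Reach c∈))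

    component-swap : component x y ≡ ∁ (component y x)
    component-swap = ⊆-antisym (x∉p⇒x∈∁p ∘ disjoint) (cover _ ∘ x∈∁p⇒x∉p)
      where
      disjoint : ∀ {c} → c ∈ component x y → c ∉ component y x
      disjoint c∈K c∈D =
        Reach-target≢ (x-side-closed (∈component⇒Reach c∈K) (∈component⇒Reach c∈D)) refl
      cover : ∀ c → c ∉ component y x → c ∈ component x y
      cover c c∉D with c ≟ y
      ... | yes refl = Reach⇒∈component (here ∈⊤ (x≢y ∘ ≡.sym))
      ... | no c≢y with Walk⇒Reach-avoiding-one x≢y (connected c x) c≢y
      ...   | inj₁ c~x = contradiction (Reach⇒∈component (Reach-sym c~x)) c∉D
      ...   | inj₂ c~y = Reach⇒∈component (Reach-sym c~y)

    parity-order-split : parity n ≡ parity ∣ component y x ∣ ℙ.+ parity ∣ component x y ∣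
    parity-order-split = begin
      parity n                                                      ≡⟨ cong parity (≡.sym (∣p∣+∣∁p∣≡n D)) ⟩
      parity (∣ D ∣ + ∣ ∁ D ∣)                                      ≡⟨ +-homo-+ ∣ D ∣ ∣ ∁ D ∣ ⟩
      parity ∣ D ∣ ℙ.+ parity ∣ ∁ D ∣                               ≡⟨ cong (λ K → parity ∣ D ∣ ℙ.+ parity ∣ K ∣) (≡.sym component-swap) ⟩
      parity ∣ D ∣ ℙ.+ parity ∣ component x y ∣                     ∎
      where
      open ≡-Reasoning
      D : Subset n
      D = component y x

    Reach-in-branch : ∀ {u c} → u ∈ component y x → Reach T ⊤ x u c → Reach T (component y x) x u c
    Reach-in-branch u∈D = Reach⊤⇒Reach (branch-closed u∈D)

    component-IsComp-branch : ∀ {u} → u ∈ component y x → IsComp T (component y x) x u (component x u)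
    component-IsComp-branch u∈D c =
      Reach-in-branch u∈D ∘ ∈component⇒Reach , Reach⇒∈component ∘ Reach⇒Reach⊤

    IsComp-branch⇒≡component : ∀ {u C} → u ∈ component y x → IsComp T (component y x) x u C → C ≡ component x u
    IsComp-branch⇒≡component u∈D C-comp = IsComp-unique C-comp (component-IsComp-branch u∈D)

    OddComp-branch⇒odd : ∀ {u} → u ∈ component y x → OddComp T (component y x) x u → parity ∣ component x u ∣ ≡ 1ℙ
    OddComp-branch⇒odd u∈D (C , C-comp , odd) =
      ≡.subst (λ D → parity ∣ D ∣ ≡ 1ℙ) (IsComp-branch⇒≡component u∈D C-comp) (odd⇒parity≡1ℙ ∣ C ∣ odd)

    odd⇒OddComp-branch : ∀ {u} → u ∈ component y x → parity ∣ component x u ∣ ≡ 1ℙ → OddComp T (component y x) x u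
    odd⇒OddComp-branch {u} u∈D odd =
      component x u , component-IsComp-branch u∈D , parity≡1ℙ⇒odd ∣ component x u ∣ odd

    component-⊂-branch : ∀ {v} → v ∈ component y x → component x v ⊂ component y x
    component-⊂-branch {v} v∈D =
        (λ c∈ → branch-closed v∈D (∈component⇒Reach {x} {v} c∈))
      , x , Reach⇒∈component (here ∈⊤ x≢y) , λ x∈ → Reach-target≢ (∈component⇒Reach {x} {v} x∈) refl

  module _ (unique : AtMostOneOddComponent) where

    edge⇒even-order : ∀ {y x} → Adj T y x → parity n ≡ 0ℙ
    edge⇒even-order {y} {x} yx with parity ∣ component y x ∣ in D-parity | parity ∣ component x y ∣ in K-parity
    ... | 1ℙ | _  = odd-component⇒even-order unique {y} {x} D-parity
    ... | 0ℙ | 1ℙ = odd-component⇒even-order unique {x} {y} K-parity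
    ... | 0ℙ | 0ℙ = trans (Edge.parity-order-split yx) (≡.cong₂ ℙ._+_ D-parity K-parity)

    branch-NEB : ∀ {y x} → Adj T y x → Acc _<_ ∣ component y x ∣ → NEB T (component y x) x
    branch-NEB {y} {x} yx (acc smaller) = neb even-branch odd-branch sub-branches
      where
      open Edge yx
      D K : Subset n
      D = component y x
      K = component x y

      K≡D-parity : parity ∣ K ∣ ≡ parity ∣ D ∣
      K≡D-parity = ≡.sym (p+q≡0ℙ⇒p≡q (trans (≡.sym parity-order-split) (edge⇒even-order yx)))

      even-branch : ¬ Odd T ∣ D ∣ →
                    (Σ (Fin n) λ u → u ∈ D × u ≢ x × OddComp T D x u)
                    × (∀ u u′ → u ∈ D → u ≢ x → u′ ∈ D → u′ ≢ x →
                         OddComp T D x u → OddComp T D x u′ → Reach T D x u u′)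
      even-branch D-even = odd-in-branch (even-order⇒odd-component (edge⇒even-order yx) x)
                         , λ u u′ u∈D _ u′∈D _ odd odd′ → Reach-in-branch u∈D
                             (unique x u u′ (odd⇒OddComp (OddComp-branch⇒odd u∈D odd))
                                            (odd⇒OddComp (OddComp-branch⇒odd u′∈D odd′)))
        where
        odd-in-branch : (∃ λ u → parity ∣ component x u ∣ ≡ 1ℙ) →
                        Σ (Fin n) λ u → u ∈ D × u ≢ x × OddComp T D x u
        odd-in-branch (u , u-odd) = u , u∈D , odd-component⇒≢ u-odd , odd⇒OddComp-branch u∈D u-odd
          where
          u∉K : u ∉ K
          u∉K u∈K = D-even (parity≡1ℙ⇒odd ∣ D ∣ (begin
            parity ∣ D ∣               ≡⟨ ≡.sym K≡D-parity ⟩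
            parity ∣ K ∣               ≡⟨ cong (λ C → parity ∣ C ∣) (component-cong (∈component⇒Reach {x} {y} u∈K)) ⟩
            parity ∣ component x u ∣   ≡⟨ u-odd ⟩
            1ℙ                         ∎))
            where open ≡-Reasoning
          u∈D : u ∈ D
          u∈D = x∉∁p⇒x∈p (u∉K ∘ ≡.subst (u ∈_) (≡.sym component-swap))

      odd-branch : Odd T ∣ D ∣ → ∀ u → u ∈ D → u ≢ x → ¬ OddComp T D x u
      odd-branch D-odd u u∈D _ odd = x∈∁p⇒x∉p (≡.subst (u ∈_) component-swap u∈K) u∈D
        where
        K-odd : parity ∣ K ∣ ≡ 1ℙ
        K-odd = trans K≡D-parity (odd⇒parity≡1ℙ ∣ D ∣ D-odd)
        u∈K : u ∈ K
        u∈K = Reach⇒∈component (unique x y u (odd⇒OddComp K-odd) (odd⇒OddComp (OddComp-branch⇒odd u∈D odd)))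

      sub-branches : ∀ v → v ∈ D → Adj T x v → ∀ C → IsComp T D x v C → NEB T C v
      sub-branches v v∈D xv C C-comp rewrite IsComp-branch⇒≡component v∈D C-comp =
        branch-NEB xv (smaller (p⊂q⇒∣p∣<∣q∣ (component-⊂-branch v∈D)))

    NEB-everywhere : ∀ v → NEB T ⊤ v
    NEB-everywhere v = neb even-tree odd-tree branches
      where
      even-tree : ¬ Odd T ∣ ⊤ {n} ∣ →
                  (Σ (Fin n) λ u → u ∈ ⊤ × u ≢ v × OddComp T ⊤ v u)
                  × (∀ u u′ → u ∈ ⊤ → u ≢ v → u′ ∈ ⊤ → u′ ≢ v →
                       OddComp T ⊤ v u → OddComp T ⊤ v u′ → Reach T ⊤ v u u′)
      even-tree T-even = odd-at-v (even-order⇒odd-component n-even v) , λ u u′ _ _ _ _ → unique v u u′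
        where
        n-even : parity n ≡ 0ℙ
        n-even = p≢1ℙ⇒p≡0ℙ λ n-odd →
          T-even (≡.subst (λ k → Odd T k) (≡.sym (∣⊤∣≡n n)) (parity≡1ℙ⇒odd n n-odd))
        odd-at-v : (∃ λ u → parity ∣ component v u ∣ ≡ 1ℙ) → Σ (Fin n) λ u → u ∈ ⊤ × u ≢ v × OddComp T ⊤ v u
        odd-at-v (u , u-odd) = u , ∈⊤ , odd-component⇒≢ u-odd , odd⇒OddComp u-odd

      odd-tree : Odd T ∣ ⊤ {n} ∣ → ∀ u → u ∈ ⊤ → u ≢ v → ¬ OddComp T ⊤ v u
      odd-tree T-odd u _ _ odd = contradiction
        (trans (≡.sym (odd⇒parity≡1ℙ n (≡.subst (λ k → Odd T k) (∣⊤∣≡n n) T-odd)))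
               (odd-component⇒even-order unique {v} {u} (OddComp⇒odd odd)))
        λ ()

      branches : ∀ z → z ∈ ⊤ → Adj T v z → ∀ C → IsComp T ⊤ v z C → NEB T C z
      branches z _ vz C C-comp rewrite IsComp-unique C-comp (component-IsComp v z) =
        branch-NEB vz (<-wellFounded ∣ component v z ∣)

mainTheorem1 : {n : ℕ} (T : SimpleGraph n) → IsTree T → (v : Fin n) →
    ¬ NEB T ⊤ v →
    Σ (Fin n) λ w → Σ (Fin n) λ u → Σ (Fin n) λ u' →
    OddComp T ⊤ w u × OddComp T ⊤ w u' × ¬ Reach T ⊤ w u u'
mainTheorem1 T tree v ¬NEB = decidable-stable two-odd-components? λ ¬two →
  ¬NEB (NEB-everywhere (λ w u u′ odd odd′ → decidable-stable (reach? w u u′) λ ¬reach →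
    ¬two (w , u , u′ , odd , odd′ , ¬reach)) v)
  where open Tree T tree
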